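{- (Forward modularity.) Let $\alpha\colon L \rightharpoonup R$, $\beta\colon G \rightharpoonup H$ and $\gamma\colon S \rightharpoonup T$ be rules, and let $f_1\colon L\to S$, $f_2\colon S\to G$, $g\colon R\to H$, $g_1\colon R\to T$ be matches such that (i) there is a derivation of the comatch $g$ from the match $f_2\circ f_1$ by $\alpha$ with corule $\beta$, and (ii) there is a derivation of the comatch $g_1$ from the match $f_1$ by $\alpha$ with corule $\gamma$. Then there is a unique match $g_2\colon T\to H$ such that $g_2\circ g_1 = g$ and $g_2\circ\gamma=\beta\circ f_2$ in the category of graphs and partial morphisms, and such that the resulting diagram is a vertical composition of derivations, i.e. $f_1 \Rightarrow_\alpha g_1$ with corule $\gamma$ and $f_2\Rightarrow_\gamma g_2$ with corule $\beta$.
   Context: A directed multigraph $G$ consists of finite sets $V_G$ (nodes) and $E_G$ (edges) and maps $s_G,t_G\colon E_G\to V_G$. A graph morphism $f\colon G\to H$ is a pair of maps $f_V\colon V_G\to V_H$, $f_E\colon E_G\to E_H$ with $s_H\circ f_E=f_V\circ s_G$ and $t_H\circ f_E=f_V\circ t_G$. A match is a morphism that is injective on nodes and edges (a monomorphism). A partial graph morphism $p\colon G\rightharpoonup H$ is represented by a span $G\xleftarrow{p_1}K\xrightarrow{p_2}H$ of morphisms with $p_1$ a monomorphism; graphs and partial morphisms form a category $\mathbf{Grph}_*$ (composition of partial maps, equivalently span composition via pullback), and total morphisms are regarded as partial morphisms. A rule $\alpha\colon L\rightharpoonup R$ is a span $L\xleftarrow{\alpha_1}K\xrightarrow{\alpha_2}R$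 with both $\alpha_1,\alpha_2$ matches. Final pullback complement (FPBC): given $X\xrightarrow{f_1}Y\xrightarrow{f_2}Z$, a pair $X\xrightarrow{g_1}W\xrightarrow{g_2}Z$ with $g_2\circ g_1=f_2\circ f_1$ making the square a pullback, such that for every pullback square $P\xrightarrow{f_1'}Y\xrightarrow{f_2}Z\xleftarrow{g_2'}Q\xleftarrow{g_1'}P$ and every morphism $p\colon P\to X$ with $f_1\circ p=f_1'$, there is a unique $u\colon Q\to W$ with $g_2\circ u=g_2'$ and $u\circ g_1'=g_1\circ p$. Derivation: given a match $f\colon L\to G$ and a rule $\alpha=(\alpha_1\colon K\to L,\alpha_2\colon K\to R)$, a derivation of a comatch $g\colon R\to H$ from $f$ by $\alpha$ is a diagram consisting of a match $h\colon K\to D$ and morphisms $\beta_1\colon D\to G$, $\beta_2\colon D\to H$ such that $K\xrightarrow{h}D\xrightarrow{\beta_1}G$ is a final pullback complement of $K\xrightarrow{\alpha_1}L\xrightarrow{f}G$, the square formed by $\alpha_2,h,g,\beta_2$ is a pushout in the category of graphs, $g$ is a match and $\beta=(\beta_1,\beta_2)\colon G\rightharpoonup H$ is a rule, called the corule. Equivalently it is a pushout of $\alpha$ along $f$ in $\mathbf{Grph}_*$ with $g\circ\alpha=\beta\circ f$. We write $f\Rightarrow_\alpha g$. -}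

module Defs where

open import Data.Nat using (ℕ)
open import Data.Fin using (Fin)
open import Data.Product using (Σ; _×_; _,_)
open import Relation.Binary.PropositionalEquality using (_≡_)
open import Function.Definitions using (Injective)
open import Function.Bundles using (_⇔_)
open import Level using (Level)

record Graph : Set where
  field
    nV  : ℕ
    nE  : ℕ
    src : Fin nE → Fin nV
    tgt : Fin nE → Fin nV

open Graph public

V : Graph → Set
V G = Fin (nV G)

E : Graph → Set
E G = Fin (nE G)

record Hom (G H : Graph) : Set where
  field
    fV    : V G → V H
    fE    : E G → E H
    s-com : ∀ e → src H (fE e) ≡ fV (src G e)
    t-com : ∀ e → tgt H (fE e) ≡ fV (tgt G e)

open Hom public

_≈_ : ∀ {G H} → Hom G H → Hom G H → Set
f ≈ g = (∀ v → fV f v ≡ fV g v) × (∀ e → fE f e ≡ fE g e)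

infix 4 _≈_

idH : ∀ {G} → Hom G G
idH = record { fV = λ v → v ; fE = λ e → e
             ; s-com = λ e → Relation.Binary.PropositionalEquality.refl
             ; t-com = λ e → Relation.Binary.PropositionalEquality.refl }

_∘H_ : ∀ {G H K} → Hom H K → Hom G H → Hom G K
_∘H_ {G} {H} {K} g f = record
  { fV = λ v → fV g (fV f v)
  ; fE = λ e → fE g (fE f e)
  ; s-com = λ e → Relation.Binary.PropositionalEquality.trans
                    (s-com g (fE f e))
                    (Relation.Binary.PropositionalEquality.cong (fV g) (s-com f e))
  ; t-com = λ e → Relation.Binary.PropositionalEquality.trans
                    (t-com g (fE f e))
                    (Relation.Binary.PropositionalEquality.cong (fV g) (t-com f e))
  }

infixr 9 _∘H_

IsMatch : ∀ {G H} → Hom G H → Set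
IsMatch f = Injective _≡_ _≡_ (fV f) × Injective _≡_ _≡_ (fE f)

∃!Hom₀ : ∀ {G H} → (Hom G H → Set) → Set
∃!Hom₀ {G} {H} P = Σ (Hom G H) λ u → P u × (∀ u' → P u' → u' ≈ u)

--      A --a₁--> B
--      |         |
--     a₂        b₁
--      v         v
--      C --b₂--> D

IsPullback : ∀ {A B C D} (a₁ : Hom A B) (a₂ : Hom A C)
             (b₁ : Hom B D) (b₂ : Hom C D) → Set
IsPullback {A} {B} {C} {D} a₁ a₂ b₁ b₂ =
  (b₁ ∘H a₁ ≈ b₂ ∘H a₂) ×
  (∀ (P : Graph) (p₁ : Hom P B) (p₂ : Hom P C) → b₁ ∘H p₁ ≈ b₂ ∘H p₂ →
     ∃!Hom₀ {P} {A} λ u → (a₁ ∘H u ≈ p₁) × (a₂ ∘H u ≈ p₂))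

IsPushout : ∀ {A B C D} (a₁ : Hom A B) (a₂ : Hom A C)
            (b₁ : Hom B D) (b₂ : Hom C D) → Set
IsPushout {A} {B} {C} {D} a₁ a₂ b₁ b₂ =
  (b₁ ∘H a₁ ≈ b₂ ∘H a₂) ×
  (∀ (Q : Graph) (q₁ : Hom B Q) (q₂ : Hom C Q) → q₁ ∘H a₁ ≈ q₂ ∘H a₂ →
     ∃!Hom₀ {D} {Q} λ u → (u ∘H b₁ ≈ q₁) × (u ∘H b₂ ≈ q₂))

IsFPBC : ∀ {X Y Z W} (f₁ : Hom X Y) (f₂ : Hom Y Z)
         (g₁ : Hom X W) (g₂ : Hom W Z) → Set
IsFPBC {X} {Y} {Z} {W} f₁ f₂ g₁ g₂ =
  (g₂ ∘H g₁ ≈ f₂ ∘H f₁) ×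
  IsPullback f₁ g₁ f₂ g₂ ×
  (∀ (P Q : Graph) (f₁' : Hom P Y) (g₁' : Hom P Q) (g₂' : Hom Q Z) →
     IsPullback f₁' g₁' f₂ g₂' →
     (p : Hom P X) → f₁ ∘H p ≈ f₁' →
     ∃!Hom₀ {Q} {W} λ u → (g₂ ∘H u ≈ g₂') × (u ∘H g₁' ≈ g₁ ∘H p))

record Rule (L R : Graph) : Set where
  field
    apex   : Graph
    left   : Hom apex L
    right  : Hom apex R
    left-match  : IsMatch left
    right-match : IsMatch right

open Rule public

Derivation : ∀ {L R G H} (f : Hom L G) (α : Rule L R)
             (g : Hom R H) (β : Rule G H) → Set
Derivation f α g β =
  IsMatch f ×
  Σ (Hom (apex α) (apex β)) λ h →
    IsMatch h ×
    IsFPBC (left α) f h (left β) ×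
    IsPushout (right α) h g (right β) ×
    IsMatch g

-- A partial
-- morphism G ⇀ H (a span G <-p₁- K -p₂-> H with p₁ mono, taken up to
-- isomorphism of K) is determined by the partial maps it induces on
-- nodes and edges; we represent morphisms of Grph_* by their graphs
-- (functional relations) on nodes and on edges.  Composition in Grph_*
-- is composition of partial maps, i.e. relational composition, and
-- equality is equality of these relations.

record PRel (G H : Graph) : Set₁ where
  field
    relV : V G → V H → Set
    relE : E G → E H → Set

open PRel public

⟦_⟧ᵣ : ∀ {G H} → Rule G H → PRel G H
⟦ ρ ⟧ᵣ = record
  { relV = λ x y → Σ (V (apex ρ)) λ k → (fV (left ρ) k ≡ x) × (fV (right ρ) k ≡ y)
  ; relE = λ x y → Σ (E (apex ρ)) λ k → (fE (left ρ) k ≡ x) × (fE (right ρ) k ≡ y)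
  }

⟦_⟧ₜ : ∀ {G H} → Hom G H → PRel G H
⟦ f ⟧ₜ = record
  { relV = λ x y → fV f x ≡ y
  ; relE = λ x y → fE f x ≡ y
  }

_⊙_ : ∀ {G H K} → PRel H K → PRel G H → PRel G K
_⊙_ {G} {H} {K} ψ φ = record
  { relV = λ x z → Σ (V H) λ y → relV φ x y × relV ψ y z
  ; relE = λ x z → Σ (E H) λ y → relE φ x y × relE ψ y z
  }

_≋_ : ∀ {G H} → PRel G H → PRel G H → Set
φ ≋ ψ = (∀ x y → relV φ x y ⇔ relV ψ x y) × (∀ x y → relE φ x y ⇔ relE ψ x y)

infix 4 _≋_

-- Write K_ρ, l_ρ, r_ρ for the interface and the legs of a rule ρ.  Finality of the FPBC of
-- the derivation with corule β, tested on the FPBC square of the one with corule γ followed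
-- by the match f₂ (still a pullback), yields u : K_γ → K_β with l_β ∘ u = f₂ ∘ l_γ; finality
-- of the FPBC of γ, tested on pullbacks along matches, makes (u, l_β) an FPBC of (l_γ, f₂).
-- The comatch g₂ is the map out of the pushout T of the γ-derivation, and by pushout pasting
-- (r_γ, u, g₂, r_β) is a pushout.  g₂ is injective because T is covered by g₁ and r_γ, and
-- because the pushout of the β-derivation is taken along the match r_α and hence is also a
-- pullback: an element of R and one of K_γ identified in H come from a common element of K_α.
-- Finally the equation g₂ ∘ γ = β ∘ f₂ in Grph_* forces g₂ ∘ r_γ = r_β ∘ u, so g₂ is unique
-- by the universal property of T.

module Submission where

open import Defs
open import Data.Nat using (ℕ; zero; suc; _+_)
open import Data.Fin using (Fin; zero; suc; splitAt; join; _≟_)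
open import Data.Fin.Properties using (any?; splitAt-join; suc-injective)
open import Data.Product using (Σ; ∃; _×_; _,_; proj₁; proj₂)
open import Data.Sum using (_⊎_; inj₁; inj₂)
open import Data.Empty using (⊥-elim)
open import Level using (0ℓ)
open import Relation.Nullary using (yes; no)
open import Relation.Unary using (Pred; Decidable; _∪_)
open import Relation.Unary.Properties using (_∪?_)
open import Relation.Binary.Bundles using (Setoid)
open import Relation.Binary.Core using (REL)
open import Relation.Binary.PropositionalEquality using (_≡_; refl; sym; trans; cong)
open import Function using (_∘_)
open import Function.Definitions using (Injective)
open import Function.Bundles using (_⇔_; mk⇔; Equivalence)
import Relation.Binary.Reasoning.Setoid as SetoidReasoning

infixr 5 _∙_
_∙_ : {A : Set} {x y z : A} → x ≡ y → y ≡ z → x ≡ z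
_∙_ = trans

-- Lemmas about equal or injective morphisms are stated on the underlying pairs
-- of maps: unification recovers the maps, but never a morphism's commutation
-- proofs.
infix 4 _≗²_
_≗²_ : {A B C D : Set} → (A → B) × (C → D) → (A → B) × (C → D) → Set
(f , f') ≗² (g , g') = (∀ x → f x ≡ g x) × (∀ e → f' e ≡ g' e)

Injective² : {A B C D : Set} → (A → B) × (C → D) → Set
Injective² (f , f') = Injective _≡_ _≡_ f × Injective _≡_ _≡_ f'

module _ {A B C D : Set} where

  ≗²-refl : {f : A → B} {f' : C → D} → (f , f') ≗² (f , f')
  ≗²-refl = (λ _ → refl) , (λ _ → refl)

  ≗²-sym : {f g : A → B} {f' g' : C → D} → (f , f') ≗² (g , g') → (g , g') ≗² (f , f')
  ≗²-sym (e , e') = sym ∘ e , sym ∘ e'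

  ≗²-trans : {f g h : A → B} {f' g' h' : C → D} →
             (f , f') ≗² (g , g') → (g , g') ≗² (h , h') → (f , f') ≗² (h , h')
  ≗²-trans (e , e') (d , d') = (λ x → e x ∙ d x) , (λ x → e' x ∙ d' x)

  injective²-resp : {f g : A → B} {f' g' : C → D} →
                    (f , f') ≗² (g , g') → Injective² (g , g') → Injective² (f , f')
  injective²-resp (e , e') (g-inj , g'-inj) = (λ eq → g-inj (sym (e _) ∙ eq ∙ e _)) ,
                                             (λ eq → g'-inj (sym (e' _) ∙ eq ∙ e' _))

≈-setoid : Graph → Graph → Setoid 0ℓ 0ℓ
≈-setoid G H = record
  { Carrier = Hom G H
  ; _≈_ = _≈_
  ; isEquivalence = record { refl = ≗²-refl ; sym = ≗²-sym ; trans = ≗²-trans }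
  }

module ≈-Reasoning {G H : Graph} = SetoidReasoning (≈-setoid G H)

module _ {X Y : Set} where

  ∘-congˡ : ∀ {B C} (h : Hom B C) {f g : X → V B} {f' g' : Y → E B} →
            (f , f') ≗² (g , g') → (fV h ∘ f , fE h ∘ f') ≗² (fV h ∘ g , fE h ∘ g')
  ∘-congˡ h (e , e') = cong (fV h) ∘ e , cong (fE h) ∘ e'

  ∘-congʳ : ∀ {A B} (h : Hom A B) {f g : V B → X} {f' g' : E B → Y} →
            (f , f') ≗² (g , g') → (f ∘ fV h , f' ∘ fE h) ≗² (g ∘ fV h , g' ∘ fE h)
  ∘-congʳ h (e , e') = e ∘ fV h , e' ∘ fE h

module _ {A A' B B' C C' : Set} where

  ∘-injective² : {g : B → C} {g' : B' → C'} {f : A → B} {f' : A' → B'} →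
                 Injective² (g , g') → Injective² (f , f') → Injective² (g ∘ f , g' ∘ f')
  ∘-injective² (g-inj , g'-inj) (f-inj , f'-inj) = f-inj ∘ g-inj , f'-inj ∘ g'-inj

  injective²-cancelˡ : {m : B → C} {m' : B' → C'} {f g : A → B} {f' g' : A' → B'} →
                       Injective² (m , m') → (m ∘ f , m' ∘ f') ≗² (m ∘ g , m' ∘ g') →
                       (f , f') ≗² (g , g')
  injective²-cancelˡ (m-inj , m'-inj) (e , e') = m-inj ∘ e , m'-inj ∘ e'

  injective²-cancelʳ : (h : B → C) (h' : B' → C') {f : A → B} {f' : A' → B'} →
                       Injective² (h ∘ f , h' ∘ f') → Injective² (f , f')
  injective²-cancelʳ h h' (i , i') = i ∘ cong h , i' ∘ cong h'

factor-through-match : ∀ {X A C} (m : Hom A C) → IsMatch m → (k : Hom X C)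
                       (hV : V X → V A) (hE : E X → E A) →
                       (∀ x → fV m (hV x) ≡ fV k x) → (∀ e → fE m (hE e) ≡ fE k e) →
                       Hom X A
factor-through-match {X} {A} {C} m (m-inj , _) k hV hE eV eE = record
  { fV = hV ; fE = hE
  ; s-com = λ e → m-inj (sym (s-com m (hE e)) ∙ cong (src C) (eE e) ∙ s-com k e ∙ sym (eV (src X e)))
  ; t-com = λ e → m-inj (sym (t-com m (hE e)) ∙ cong (tgt C) (eE e) ∙ t-com k e ∙ sym (eV (tgt X e)))
  }

-- Enumerations and subgraphs

Image : {A B : Set} → (A → B) → Pred B 0ℓ
Image f y = ∃ λ x → f x ≡ y

image? : ∀ {m n} (f : Fin m → Fin n) → Decidable (Image f)
image? f y = any? (λ x → f x ≟ y)

record Enumeration {n : ℕ} (P : Pred (Fin n) 0ℓ) : Set where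
  field
    size   : ℕ
    elem   : Fin size → Fin n
    elem-P : ∀ i → P (elem i)
    elem-injective : Injective _≡_ _≡_ elem
    find   : ∀ x → P x → ∃ λ i → elem i ≡ x

enumerate : ∀ {n} {P : Pred (Fin n) 0ℓ} → Decidable P → Enumeration P
enumerate {zero} P? = record
  { size = 0 ; elem = λ () ; elem-P = λ () ; elem-injective = λ { {()} } ; find = λ () }
enumerate {suc n} {P} P? with P? zero | enumerate {P = P ∘ suc} (P? ∘ suc)
... | no ¬P0 | rest = record
  { size = size ; elem = suc ∘ elem ; elem-P = elem-P
  ; elem-injective = elem-injective ∘ suc-injective ; find = find' }
  where
  open Enumeration rest
  find' : ∀ x → P x → ∃ λ i → suc (elem i) ≡ x
  find' zero    p = ⊥-elim (¬P0 p)
  find' (suc x) p = let i , eq = find x p in i , cong suc eq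
... | yes P0 | rest = record
  { size = suc size ; elem = elem' ; elem-P = elem-P' ; elem-injective = injective' ; find = find' }
  where
  open Enumeration rest
  elem' : Fin (suc size) → Fin (suc n)
  elem' zero    = zero
  elem' (suc i) = suc (elem i)
  elem-P' : ∀ i → P (elem' i)
  elem-P' zero    = P0
  elem-P' (suc i) = elem-P i
  injective' : Injective _≡_ _≡_ elem'
  injective' {zero}  {zero}  _  = refl
  injective' {suc i} {suc j} eq = cong suc (elem-injective (suc-injective eq))
  find' : ∀ x → P x → ∃ λ i → elem' i ≡ x
  find' zero    _ = zero , refl
  find' (suc x) p = let i , eq = find x p in suc i , cong suc eq

module InducedSubgraph (B : Graph) {PV : Pred (V B) 0ℓ} {PE : Pred (E B) 0ℓ}
                       (PV? : Decidable PV) (PE? : Decidable PE)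
                       (src-closed : ∀ {e} → PE e → PV (src B e))
                       (tgt-closed : ∀ {e} → PE e → PV (tgt B e)) where
  private
    module N = Enumeration (enumerate PV?)
    module M = Enumeration (enumerate PE?)

    srcᴵ : (i : Fin M.size) → ∃ λ j → N.elem j ≡ src B (M.elem i)
    srcᴵ i = N.find (src B (M.elem i)) (src-closed (M.elem-P i))

    tgtᴵ : (i : Fin M.size) → ∃ λ j → N.elem j ≡ tgt B (M.elem i)
    tgtᴵ i = N.find (tgt B (M.elem i)) (tgt-closed (M.elem-P i))

  graph : Graph
  graph = record { nV = N.size ; nE = M.size ; src = proj₁ ∘ srcᴵ ; tgt = proj₁ ∘ tgtᴵ }

  ι : Hom graph B
  ι = record { fV = N.elem ; fE = M.elem
             ; s-com = sym ∘ proj₂ ∘ srcᴵ ; t-com = sym ∘ proj₂ ∘ tgtᴵ }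

  ι-match : IsMatch ι
  ι-match = N.elem-injective , M.elem-injective

  ι-PV : ∀ v → PV (fV ι v)
  ι-PV = N.elem-P

  ι-PE : ∀ e → PE (fE ι e)
  ι-PE = M.elem-P

  corestrict : ∀ {Z} (k : Hom Z B) → (∀ z → PV (fV k z)) → (∀ e → PE (fE k e)) →
               Σ (Hom Z graph) λ h → ι ∘H h ≈ k
  corestrict k kV kE =
    factor-through-match ι ι-match k (proj₁ ∘ findV) (proj₁ ∘ findE) (proj₂ ∘ findV) (proj₂ ∘ findE) ,
    proj₂ ∘ findV , proj₂ ∘ findE
    where
    findV : ∀ z → ∃ λ i → N.elem i ≡ fV k z
    findV z = N.find (fV k z) (kV z)
    findE : ∀ e → ∃ λ i → M.elem i ≡ fE k e
    findE e = M.find (fE k e) (kE e)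

record Pullback {A B C : Graph} (m : Hom A C) (b : Hom B C) : Set where
  field
    P          : Graph
    π₁         : Hom P A
    π₂         : Hom P B
    isPullback : IsPullback π₁ π₂ m b

-- The pullback of a match m along b is the subgraph of B induced by the preimage of the image of m.
pullback-of-match : ∀ {A B C} (m : Hom A C) → IsMatch m → (b : Hom B C) → Pullback m b
pullback-of-match {A} {B} {C} m m-match b = record
  { P = graph ; π₁ = π₁ ; π₂ = ι ; isPullback = square , universal }
  where
  src-closed : ∀ {e} → Image (fE m) (fE b e) → Image (fV m) (fV b (src B e))
  src-closed (a , eq) = src A a , sym (s-com m a) ∙ cong (src C) eq ∙ s-com b _

  tgt-closed : ∀ {e} → Image (fE m) (fE b e) → Image (fV m) (fV b (tgt B e))
  tgt-closed (a , eq) = tgt A a , sym (t-com m a) ∙ cong (tgt C) eq ∙ t-com b _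

  open InducedSubgraph B (image? (fV m) ∘ fV b) (image? (fE m) ∘ fE b) src-closed tgt-closed
  open ≈-Reasoning

  π₁ : Hom graph A
  π₁ = factor-through-match m m-match (b ∘H ι) (proj₁ ∘ ι-PV) (proj₁ ∘ ι-PE)
                            (proj₂ ∘ ι-PV) (proj₂ ∘ ι-PE)

  square : m ∘H π₁ ≈ b ∘H ι
  square = proj₂ ∘ ι-PV , proj₂ ∘ ι-PE

  universal : ∀ Z (p₁ : Hom Z A) (p₂ : Hom Z B) → m ∘H p₁ ≈ b ∘H p₂ →
              ∃!Hom₀ λ h → (π₁ ∘H h ≈ p₁) × (ι ∘H h ≈ p₂)
  universal Z p₁ p₂ mp₁≈bp₂@(cV , cE) =
    let h , ιh≈p₂ = corestrict p₂ (λ z → fV p₁ z , cV z) (λ e → fE p₁ e , cE e)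
    in h , (π₁h≈p₁ h ιh≈p₂ , ιh≈p₂) ,
       λ h' (_ , ιh'≈p₂) → injective²-cancelˡ ι-match (≗²-trans ιh'≈p₂ (≗²-sym ιh≈p₂))
    where
    π₁h≈p₁ : (h : Hom Z graph) → ι ∘H h ≈ p₂ → π₁ ∘H h ≈ p₁
    π₁h≈p₁ h ιh≈p₂ = injective²-cancelˡ m-match (begin
      m ∘H π₁ ∘H h ≈⟨ ∘-congʳ h square ⟩
      b ∘H ι ∘H h  ≈⟨ ∘-congˡ b ιh≈p₂ ⟩
      b ∘H p₂      ≈⟨ mp₁≈bp₂ ⟨
      m ∘H p₁      ∎)

-- Amalgamation and joint surjectivity

Amalgamatesᶠ : {A B C D : Set} (a₁ : A → B) (a₂ : A → C) (b₁ : B → D) (b₂ : C → D) → Set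
Amalgamatesᶠ a₁ a₂ b₁ b₂ = ∀ x y → b₁ x ≡ b₂ y → ∃ λ k → a₁ k ≡ x × a₂ k ≡ y

Amalgamates : ∀ {A B C D} (a₁ : Hom A B) (a₂ : Hom A C) (b₁ : Hom B D) (b₂ : Hom C D) → Set
Amalgamates a₁ a₂ b₁ b₂ = Amalgamatesᶠ (fV a₁) (fV a₂) (fV b₁) (fV b₂) ×
                          Amalgamatesᶠ (fE a₁) (fE a₂) (fE b₁) (fE b₂)

JointlySurjectiveᶠ : {B C D : Set} (b₁ : B → D) (b₂ : C → D) → Set
JointlySurjectiveᶠ b₁ b₂ = ∀ d → (Image b₁ ∪ Image b₂) d

JointlySurjective : ∀ {B C D} (b₁ : Hom B D) (b₂ : Hom C D) → Set
JointlySurjective b₁ b₂ = JointlySurjectiveᶠ (fV b₁) (fV b₂) × JointlySurjectiveᶠ (fE b₁) (fE b₂)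

point : Graph
point = record { nV = 1 ; nE = 0 ; src = λ () ; tgt = λ () }

pointAt : ∀ {G} → V G → Hom point G
pointAt x = record { fV = λ _ → x ; fE = λ () ; s-com = λ () ; t-com = λ () }

arrow : Graph
arrow = record { nV = 2 ; nE = 1 ; src = λ _ → zero ; tgt = λ _ → suc zero }

arrowAt : ∀ {G} → E G → Hom arrow G
arrowAt {G} e = record { fV = endpoint ; fE = λ _ → e ; s-com = λ _ → refl ; t-com = λ _ → refl }
  where
  endpoint : Fin 2 → V G
  endpoint zero    = src G e
  endpoint (suc _) = tgt G e

pullback⇒amalgamates : ∀ {A B C D} (a₁ : Hom A B) (a₂ : Hom A C) (b₁ : Hom B D) (b₂ : Hom C D) →
                       IsPullback a₁ a₂ b₁ b₂ → Amalgamates a₁ a₂ b₁ b₂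
pullback⇒amalgamates {D = D} a₁ a₂ b₁ b₂ (_ , universal) = amalgamateV , amalgamateE
  where
  amalgamateV : Amalgamatesᶠ (fV a₁) (fV a₂) (fV b₁) (fV b₂)
  amalgamateV x y eq =
    let u , ((u₁ , _) , (u₂ , _)) , _ = universal point (pointAt x) (pointAt y) ((λ _ → eq) , λ ())
    in fV u zero , u₁ zero , u₂ zero

  amalgamateE : Amalgamatesᶠ (fE a₁) (fE a₂) (fE b₁) (fE b₂)
  amalgamateE x y eq =
    let u , ((_ , u₁) , (_ , u₂)) , _ = universal arrow (arrowAt x) (arrowAt y) (endpoints , λ _ → eq)
    in fE u zero , u₁ zero , u₂ zero
    where
    endpoints : ∀ i → fV b₁ (fV (arrowAt x) i) ≡ fV b₂ (fV (arrowAt y) i)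
    endpoints zero    = sym (s-com b₁ x) ∙ cong (src D) eq ∙ s-com b₂ y
    endpoints (suc _) = sym (t-com b₁ x) ∙ cong (tgt D) eq ∙ t-com b₂ y

join-injective : ∀ m n → Injective _≡_ _≡_ (join m n)
join-injective m n {x} {y} eq = sym (splitAt-join m n x) ∙ cong (splitAt m) eq ∙ splitAt-join m n y

module Glued (X Y : Graph) (ρ : V Y → V X ⊎ V Y) where
  srcᵍ tgtᵍ : E X ⊎ E Y → V X ⊎ V Y
  srcᵍ (inj₁ e) = inj₁ (src X e)
  srcᵍ (inj₂ e) = ρ (src Y e)
  tgtᵍ (inj₁ e) = inj₁ (tgt X e)
  tgtᵍ (inj₂ e) = ρ (tgt Y e)

  graph : Graph
  graph = record { nV = nV X + nV Y ; nE = nE X + nE Y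
                 ; src = join _ _ ∘ srcᵍ ∘ splitAt (nE X)
                 ; tgt = join _ _ ∘ tgtᵍ ∘ splitAt (nE X) }

  into : ∀ {Z} (hV : V Z → V X ⊎ V Y) (hE : E Z → E X ⊎ E Y) →
         (∀ e → srcᵍ (hE e) ≡ hV (src Z e)) → (∀ e → tgtᵍ (hE e) ≡ hV (tgt Z e)) →
         Hom Z graph
  into hV hE s-ok t-ok = record
    { fV = join _ _ ∘ hV ; fE = join _ _ ∘ hE
    ; s-com = λ e → cong (join _ _ ∘ srcᵍ) (splitAt-join _ _ (hE e)) ∙ cong (join _ _) (s-ok e)
    ; t-com = λ e → cong (join _ _ ∘ tgtᵍ) (splitAt-join _ _ (hE e)) ∙ cong (join _ _) (t-ok e) }

  inl : Hom X graph
  inl = into inj₁ inj₁ (λ _ → refl) (λ _ → refl)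

mark : ∀ {n} {P : Pred (Fin n) 0ℓ} → Decidable P → Fin n → Fin n ⊎ Fin n
mark P? x with P? x
... | yes _ = inj₁ x
... | no  _ = inj₂ x

mark-yes : ∀ {n} {P : Pred (Fin n) 0ℓ} (P? : Decidable P) {x} → P x → mark P? x ≡ inj₁ x
mark-yes P? {x} p with P? x
... | yes _ = refl
... | no ¬p = ⊥-elim (¬p p)

mark-inj₁ : ∀ {n} {P : Pred (Fin n) 0ℓ} (P? : Decidable P) {x y} → mark P? x ≡ inj₁ y → P x
mark-inj₁ P? {x} eq with P? x
mark-inj₁ P? eq | yes p = p
mark-inj₁ P? () | no  _

glue : ∀ {k m n} (f : Fin k → Fin m) (g : Fin k → Fin n) → Fin m → Fin n ⊎ Fin m
glue f g x with image? f x
... | yes (k , _) = inj₁ (g k)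
... | no  _       = inj₂ x

glue-image : ∀ {k m n} {f : Fin k → Fin m} (g : Fin k → Fin n) →
             Injective _≡_ _≡_ f → ∀ i → glue f g (f i) ≡ inj₁ (g i)
glue-image {f = f} g f-inj i with image? f (f i)
... | yes (j , fj≡fi) = cong (inj₁ ∘ g) (f-inj fj≡fi)
... | no  ∉           = ⊥-elim (∉ (i , refl))

glue-inj₁ : ∀ {k m n} (f : Fin k → Fin m) (g : Fin k → Fin n) {x y} →
            glue f g x ≡ inj₁ y → ∃ λ i → f i ≡ x × g i ≡ y
glue-inj₁ f g {x} eq with image? f x
glue-inj₁ f g refl | yes (i , fi≡x) = i , fi≡x , refl
glue-inj₁ f g ()   | no  _

module PushoutProperties {A B C D : Graph} (a₁ : Hom A B) (a₂ : Hom A C) (b₁ : Hom B D) (b₂ : Hom C D)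
                         (po : IsPushout a₁ a₂ b₁ b₂) where

  jointly-epi : ∀ {Q} (w w' : Hom D Q) → w ∘H b₁ ≈ w' ∘H b₁ → w ∘H b₂ ≈ w' ∘H b₂ → w ≈ w'
  jointly-epi w w' e₁ e₂ =
    let _ , _ , unique = proj₂ po _ (w ∘H b₁) (w ∘H b₂) (∘-congˡ w (proj₁ po))
    in ≗²-trans (unique w (≗²-refl , ≗²-refl)) (≗²-sym (unique w' (≗²-sym e₁ , ≗²-sym e₂)))

  -- Two maps into a copy of D ⊎ D that agree on the images of b₁ and b₂ only.
  jointly-surjective : JointlySurjective b₁ b₂
  jointly-surjective =
    (λ d → mark-inj₁ imageV? (sym (join-injective _ _ (proj₁ inl≈marked d)))) ,
    (λ e → mark-inj₁ imageE? (sym (join-injective _ _ (proj₂ inl≈marked e))))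
    where
    imageV? : Decidable (Image (fV b₁) ∪ Image (fV b₂))
    imageV? = image? (fV b₁) ∪? image? (fV b₂)

    imageE? : Decidable (Image (fE b₁) ∪ Image (fE b₂))
    imageE? = image? (fE b₁) ∪? image? (fE b₂)

    open Glued D D (mark imageV?)

    srcᵐ : ∀ e → srcᵍ (mark imageE? e) ≡ mark imageV? (src D e)
    srcᵐ e with imageE? e
    ... | yes (inj₁ (x , refl)) = sym (mark-yes imageV? (inj₁ (src B x , sym (s-com b₁ x))))
    ... | yes (inj₂ (y , refl)) = sym (mark-yes imageV? (inj₂ (src C y , sym (s-com b₂ y))))
    ... | no  _                 = refl

    tgtᵐ : ∀ e → tgtᵍ (mark imageE? e) ≡ mark imageV? (tgt D e)
    tgtᵐ e with imageE? e
    ... | yes (inj₁ (x , refl)) = sym (mark-yes imageV? (inj₁ (tgt B x , sym (t-com b₁ x))))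
    ... | yes (inj₂ (y , refl)) = sym (mark-yes imageV? (inj₂ (tgt C y , sym (t-com b₂ y))))
    ... | no  _                 = refl

    marked : Hom D graph
    marked = into (mark imageV?) (mark imageE?) srcᵐ tgtᵐ

    inl≈marked : inl ≈ marked
    inl≈marked = jointly-epi inl marked
      ((λ x → cong (join _ _) (sym (mark-yes imageV? (inj₁ (x , refl))))) ,
       (λ x → cong (join _ _) (sym (mark-yes imageE? (inj₁ (x , refl))))))
      ((λ y → cong (join _ _) (sym (mark-yes imageV? (inj₂ (y , refl))))) ,
       (λ y → cong (join _ _) (sym (mark-yes imageE? (inj₂ (y , refl))))))

  -- Tested against the pushout built by hand: C together with the part of B outside the image of a₁.
  amalgamates : IsMatch a₁ → Amalgamates a₁ a₂ b₁ b₂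
  amalgamates (a₁-inj , a₁-inj') =
    let w , (w∘b₁≈glued , w∘b₂≈inl) , _ = proj₂ po graph glued inl glued∘a₁≈inl∘a₂
    in (λ x y eq → glue-inj₁ (fV a₁) (fV a₂)
          (join-injective _ _ (sym (proj₁ w∘b₁≈glued x) ∙ cong (fV w) eq ∙ proj₁ w∘b₂≈inl y))) ,
       (λ x y eq → glue-inj₁ (fE a₁) (fE a₂)
          (join-injective _ _ (sym (proj₂ w∘b₁≈glued x) ∙ cong (fE w) eq ∙ proj₂ w∘b₂≈inl y)))
    where
    glueV : V B → V C ⊎ V B
    glueV = glue (fV a₁) (fV a₂)

    glueE : E B → E C ⊎ E B
    glueE = glue (fE a₁) (fE a₂)

    open Glued C B glueV

    srcᵍ-glue : ∀ e → srcᵍ (glueE e) ≡ glueV (src B e)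
    srcᵍ-glue e with image? (fE a₁) e
    ... | yes (k , refl) = cong inj₁ (s-com a₂ k) ∙ sym (glue-image (fV a₂) a₁-inj (src A k))
                           ∙ cong glueV (sym (s-com a₁ k))
    ... | no  _          = refl

    tgtᵍ-glue : ∀ e → tgtᵍ (glueE e) ≡ glueV (tgt B e)
    tgtᵍ-glue e with image? (fE a₁) e
    ... | yes (k , refl) = cong inj₁ (t-com a₂ k) ∙ sym (glue-image (fV a₂) a₁-inj (tgt A k))
                           ∙ cong glueV (sym (t-com a₁ k))
    ... | no  _          = refl

    glued : Hom B graph
    glued = into glueV glueE srcᵍ-glue tgtᵍ-glue

    glued∘a₁≈inl∘a₂ : glued ∘H a₁ ≈ inl ∘H a₂
    glued∘a₁≈inl∘a₂ = cong (join _ _) ∘ glue-image (fV a₂) a₁-inj ,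
                      cong (join _ _) ∘ glue-image (fE a₂) a₁-inj'

-- Decomposing derivations

pullback-postcompose-match : ∀ {A B C D D'} (a₁ : Hom A B) (a₂ : Hom A C) (b₁ : Hom B D) (b₂ : Hom C D)
                             (m : Hom D D') → IsMatch m →
                             IsPullback a₁ a₂ b₁ b₂ → IsPullback a₁ a₂ (m ∘H b₁) (m ∘H b₂)
pullback-postcompose-match _ _ _ _ m m-match (comm , universal) =
  ∘-congˡ m comm , λ Z p₁ p₂ c → universal Z p₁ p₂ (injective²-cancelˡ m-match c)

IsFinalComplement : ∀ {X Y Z W} (f₁ : Hom X Y) (f₂ : Hom Y Z) (g₁ : Hom X W) (g₂ : Hom W Z) → Set
IsFinalComplement {X} {Y} {Z} {W} f₁ f₂ g₁ g₂ =
  ∀ (P Q : Graph) (f₁' : Hom P Y) (g₁' : Hom P Q) (g₂' : Hom Q Z) →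
    IsPullback f₁' g₁' f₂ g₂' → (p : Hom P X) → f₁ ∘H p ≈ f₁' →
    ∃!Hom₀ {Q} {W} λ u → (g₂ ∘H u ≈ g₂') × (u ∘H g₁' ≈ g₁ ∘H p)

module FPBCDecomposition
  {K L S G D₁ D₂ : Graph} (l : Hom K L) (f₁ : Hom L S) (f₂ : Hom S G)
  (h₁ : Hom K D₁) (l₁ : Hom D₁ S) (h₂ : Hom K D₂) (l₂ : Hom D₂ G)
  (f₁-match : IsMatch f₁) (f₂-match : IsMatch f₂) (l₁-match : IsMatch l₁) (l₂-match : IsMatch l₂)
  (inner : IsFPBC l f₁ h₁ l₁) (outer : IsFPBC l (f₂ ∘H f₁) h₂ l₂) where

  open ≈-Reasoning
  private
    pb₁ : IsPullback l h₁ f₁ l₁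
    pb₁ = proj₁ (proj₂ inner)

    final₁ : IsFinalComplement l f₁ h₁ l₁
    final₁ = proj₂ (proj₂ inner)

    pb₂ : IsPullback l h₂ (f₂ ∘H f₁) l₂
    pb₂ = proj₁ (proj₂ outer)

    final₂ : IsFinalComplement l (f₂ ∘H f₁) h₂ l₂
    final₂ = proj₂ (proj₂ outer)

    mediator : ∃!Hom₀ λ u → (l₂ ∘H u ≈ f₂ ∘H l₁) × (u ∘H h₁ ≈ h₂ ∘H idH)
    mediator = final₂ K D₁ l h₁ (f₂ ∘H l₁) (pullback-postcompose-match l h₁ f₁ l₁ f₂ f₂-match pb₁)
                      idH ≗²-refl

  u : Hom D₁ D₂
  u = proj₁ mediator

  l₂∘u≈f₂∘l₁ : l₂ ∘H u ≈ f₂ ∘H l₁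
  l₂∘u≈f₂∘l₁ = proj₁ (proj₁ (proj₂ mediator))

  u∘h₁≈h₂ : u ∘H h₁ ≈ h₂
  u∘h₁≈h₂ = proj₂ (proj₁ (proj₂ mediator))

  u-match : IsMatch u
  u-match = injective²-cancelʳ (fV l₂) (fE l₂)
              (injective²-resp l₂∘u≈f₂∘l₁ (∘-injective² f₂-match l₁-match))

  isFPBC : IsFPBC l₁ f₂ u l₂
  isFPBC = l₂∘u≈f₂∘l₁ , pullback , final
    where
    pullback : IsPullback l₁ u f₂ l₂
    pullback = ≗²-sym l₂∘u≈f₂∘l₁ , factor
      where
      factor : ∀ Z (p₁ : Hom Z S) (p₂ : Hom Z D₂) → f₂ ∘H p₁ ≈ l₂ ∘H p₂ →
               ∃!Hom₀ λ v → (l₁ ∘H v ≈ p₁) × (u ∘H v ≈ p₂)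
      factor Z p₁ p₂ f₂p₁≈l₂p₂ =
        let k , (lk≈π₁ , _) , _  = proj₂ pb₂ P π₁ (p₂ ∘H π₂) f₂f₁π₁≈l₂p₂π₂
            v , (l₁v≈p₁ , _) , _ = final₁ P Z π₁ π₂ p₁ isPullback k lk≈π₁
        in v , (l₁v≈p₁ , u∘-≈p₂ v l₁v≈p₁) ,
           λ v' (l₁v'≈p₁ , _) → injective²-cancelˡ l₁-match (≗²-trans l₁v'≈p₁ (≗²-sym l₁v≈p₁))
        where
        open Pullback (pullback-of-match f₁ f₁-match p₁)

        f₂f₁π₁≈l₂p₂π₂ : f₂ ∘H f₁ ∘H π₁ ≈ l₂ ∘H p₂ ∘H π₂
        f₂f₁π₁≈l₂p₂π₂ = begin
          f₂ ∘H f₁ ∘H π₁ ≈⟨ ∘-congˡ f₂ (proj₁ isPullback) ⟩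
          f₂ ∘H p₁ ∘H π₂ ≈⟨ ∘-congʳ π₂ f₂p₁≈l₂p₂ ⟩
          l₂ ∘H p₂ ∘H π₂ ∎

        u∘-≈p₂ : (v : Hom Z D₁) → l₁ ∘H v ≈ p₁ → u ∘H v ≈ p₂
        u∘-≈p₂ v l₁v≈p₁ = injective²-cancelˡ l₂-match (begin
          l₂ ∘H u ∘H v  ≈⟨ ∘-congʳ v l₂∘u≈f₂∘l₁ ⟩
          f₂ ∘H l₁ ∘H v ≈⟨ ∘-congˡ f₂ l₁v≈p₁ ⟩
          f₂ ∘H p₁      ≈⟨ f₂p₁≈l₂p₂ ⟩
          l₂ ∘H p₂      ∎)

    final : IsFinalComplement l₁ f₂ u l₂
    final P Q f₁' g₁' g₂' pbQ p l₁p≈f₁' =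
      let y , (f₁'y≈f₁π₁ , _) , _ = proj₂ pbQ R (f₁ ∘H π₁) π₂ (proj₁ isPullback)
          k , (lk≈π₁ , _) , _     = proj₂ pb₁ R π₁ (p ∘H y) (f₁π₁≈l₁py y f₁'y≈f₁π₁)
          v , (l₂v≈g₂' , _) , _   = final₂ R Q π₁ π₂ g₂' isPullback k lk≈π₁
      in v , (l₂v≈g₂' , vg₁'≈up v l₂v≈g₂') ,
         λ v' (l₂v'≈g₂' , _) → injective²-cancelˡ l₂-match (≗²-trans l₂v'≈g₂' (≗²-sym l₂v≈g₂'))
      where
      open Pullback (pullback-of-match (f₂ ∘H f₁) (∘-injective² f₂-match f₁-match) g₂') renaming (P to R)

      f₁π₁≈l₁py : (y : Hom R P) → f₁' ∘H y ≈ f₁ ∘H π₁ → f₁ ∘H π₁ ≈ l₁ ∘H p ∘H y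
      f₁π₁≈l₁py y f₁'y≈f₁π₁ = begin
        f₁ ∘H π₁      ≈⟨ f₁'y≈f₁π₁ ⟨
        f₁' ∘H y      ≈⟨ ∘-congʳ y l₁p≈f₁' ⟨
        l₁ ∘H p ∘H y  ∎

      vg₁'≈up : (v : Hom Q D₂) → l₂ ∘H v ≈ g₂' → v ∘H g₁' ≈ u ∘H p
      vg₁'≈up v l₂v≈g₂' = injective²-cancelˡ l₂-match (begin
        l₂ ∘H v ∘H g₁' ≈⟨ ∘-congʳ g₁' l₂v≈g₂' ⟩
        g₂' ∘H g₁'     ≈⟨ proj₁ pbQ ⟨
        f₂ ∘H f₁'      ≈⟨ ∘-congˡ f₂ l₁p≈f₁' ⟨
        f₂ ∘H l₁ ∘H p  ≈⟨ ∘-congʳ p l₂∘u≈f₂∘l₁ ⟨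
        l₂ ∘H u ∘H p   ∎)

mediator-injective :
  {A B C D C' D' : Set} {a₁ : A → B} {a₂ : A → C} {b₁ : B → D} {b₂ : C → D}
  {a₂' : A → C'} {b₁' : B → D'} {b₂' : C' → D'} {c : C → C'} {d : D → D'} →
  JointlySurjectiveᶠ b₁ b₂ → (∀ x → b₁ (a₁ x) ≡ b₂ (a₂ x)) →
  Amalgamatesᶠ a₁ a₂' b₁' b₂' → (∀ x → c (a₂ x) ≡ a₂' x) →
  (∀ x → d (b₁ x) ≡ b₁' x) → (∀ y → d (b₂ y) ≡ b₂' (c y)) →
  Injective _≡_ _≡_ b₁' → Injective _≡_ _≡_ b₂' → Injective _≡_ _≡_ c → Injective _≡_ _≡_ d
mediator-injective {b₁ = b₁} {b₂} {c = c} {d} cover comm amalgamate ca₂≡a₂' db₁≡b₁' db₂≡b₂'c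
                   b₁'-inj b₂'-inj c-inj = injective
  where
  across : ∀ x y → d (b₁ x) ≡ d (b₂ y) → b₁ x ≡ b₂ y
  across x y eq =
    let k , a₁k≡x , a₂'k≡cy = amalgamate x (c y) (sym (db₁≡b₁' x) ∙ eq ∙ db₂≡b₂'c y)
    in cong b₁ (sym a₁k≡x) ∙ comm k ∙ cong b₂ (c-inj (ca₂≡a₂' k ∙ a₂'k≡cy))

  injective : Injective _≡_ _≡_ d
  injective {t} {t'} eq with cover t | cover t'
  ... | inj₁ (x , refl) | inj₁ (x' , refl) = cong b₁ (b₁'-inj (sym (db₁≡b₁' x) ∙ eq ∙ db₁≡b₁' x'))
  ... | inj₁ (x , refl) | inj₂ (y  , refl) = across x y eq
  ... | inj₂ (y , refl) | inj₁ (x  , refl) = sym (across x y (sym eq))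
  ... | inj₂ (y , refl) | inj₂ (y' , refl) = cong b₂ (c-inj (b₂'-inj (sym (db₂≡b₂'c y) ∙ eq ∙ db₂≡b₂'c y')))

module PushoutDecomposition
  {A B C D C' D' : Graph} (a₁ : Hom A B) (a₂ : Hom A C) (b₁ : Hom B D) (b₂ : Hom C D)
  (a₂' : Hom A C') (b₁' : Hom B D') (b₂' : Hom C' D') (c : Hom C C')
  (po : IsPushout a₁ a₂ b₁ b₂) (po' : IsPushout a₁ a₂' b₁' b₂') (ca₂≈a₂' : c ∘H a₂ ≈ a₂') where

  open ≈-Reasoning
  private
    module P  = PushoutProperties a₁ a₂ b₁ b₂ po
    module P' = PushoutProperties a₁ a₂' b₁' b₂' po'

    mediator : ∃!Hom₀ λ d → (d ∘H b₁ ≈ b₁') × (d ∘H b₂ ≈ b₂' ∘H c)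
    mediator = proj₂ po D' b₁' (b₂' ∘H c) (begin
      b₁' ∘H a₁      ≈⟨ proj₁ po' ⟩
      b₂' ∘H a₂'     ≈⟨ ∘-congˡ b₂' ca₂≈a₂' ⟨
      b₂' ∘H c ∘H a₂ ∎)

  d : Hom D D'
  d = proj₁ mediator

  d∘b₁≈b₁' : d ∘H b₁ ≈ b₁'
  d∘b₁≈b₁' = proj₁ (proj₁ (proj₂ mediator))

  d∘b₂≈b₂'∘c : d ∘H b₂ ≈ b₂' ∘H c
  d∘b₂≈b₂'∘c = proj₂ (proj₁ (proj₂ mediator))

  isPushout : IsPushout b₂ c d b₂'
  isPushout = d∘b₂≈b₂'∘c , universal
    where
    universal : ∀ Q (q₁ : Hom D Q) (q₂ : Hom C' Q) → q₁ ∘H b₂ ≈ q₂ ∘H c →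
                ∃!Hom₀ λ w → (w ∘H d ≈ q₁) × (w ∘H b₂' ≈ q₂)
    universal Q q₁ q₂ q₁b₂≈q₂c =
      let w , (wb₁'≈q₁b₁ , wb₂'≈q₂) , _ = proj₂ po' Q (q₁ ∘H b₁) q₂ q₁b₁a₁≈q₂a₂'
      in w , (wd≈q₁ w wb₁'≈q₁b₁ wb₂'≈q₂ , wb₂'≈q₂) ,
         λ w' (w'd≈q₁ , w'b₂'≈q₂) → P'.jointly-epi w' w
           (begin
             w' ∘H b₁'     ≈⟨ ∘-congˡ w' d∘b₁≈b₁' ⟨
             w' ∘H d ∘H b₁ ≈⟨ ∘-congʳ b₁ w'd≈q₁ ⟩
             q₁ ∘H b₁      ≈⟨ wb₁'≈q₁b₁ ⟨
             w ∘H b₁'      ∎)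
           (≗²-trans w'b₂'≈q₂ (≗²-sym wb₂'≈q₂))
      where
      q₁b₁a₁≈q₂a₂' : q₁ ∘H b₁ ∘H a₁ ≈ q₂ ∘H a₂'
      q₁b₁a₁≈q₂a₂' = begin
        q₁ ∘H b₁ ∘H a₁ ≈⟨ ∘-congˡ q₁ (proj₁ po) ⟩
        q₁ ∘H b₂ ∘H a₂ ≈⟨ ∘-congʳ a₂ q₁b₂≈q₂c ⟩
        q₂ ∘H c ∘H a₂  ≈⟨ ∘-congˡ q₂ ca₂≈a₂' ⟩
        q₂ ∘H a₂'      ∎

      wd≈q₁ : (w : Hom D' Q) → w ∘H b₁' ≈ q₁ ∘H b₁ → w ∘H b₂' ≈ q₂ → w ∘H d ≈ q₁
      wd≈q₁ w wb₁'≈q₁b₁ wb₂'≈q₂ = P.jointly-epi (w ∘H d) q₁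
        (≗²-trans (∘-congˡ w d∘b₁≈b₁') wb₁'≈q₁b₁)
        (begin
          w ∘H d ∘H b₂  ≈⟨ ∘-congˡ w d∘b₂≈b₂'∘c ⟩
          w ∘H b₂' ∘H c ≈⟨ ∘-congʳ c wb₂'≈q₂ ⟩
          q₂ ∘H c       ≈⟨ q₁b₂≈q₂c ⟨
          q₁ ∘H b₂      ∎)

  d-match : IsMatch a₁ → IsMatch c → IsMatch b₁' → IsMatch b₂' → IsMatch d
  d-match a₁-match (cV , cE) (b₁'V , b₁'E) (b₂'V , b₂'E) =
    mediator-injective (proj₁ P.jointly-surjective) (proj₁ (proj₁ po)) (proj₁ amalgamate)
                       (proj₁ ca₂≈a₂') (proj₁ d∘b₁≈b₁') (proj₁ d∘b₂≈b₂'∘c) b₁'V b₂'V cV ,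
    mediator-injective (proj₂ P.jointly-surjective) (proj₂ (proj₁ po)) (proj₂ amalgamate)
                       (proj₂ ca₂≈a₂') (proj₂ d∘b₁≈b₁') (proj₂ d∘b₂≈b₂'∘c) b₁'E b₂'E cE
    where
    amalgamate : Amalgamates a₁ a₂' b₁' b₂'
    amalgamate = P'.amalgamates a₁-match

-- Partial morphisms

-- Relational composition; the library's `_;_` cannot be referred to, `;` being reserved.
infixr 9 _⨾_
_⨾_ : {A B C : Set} → REL A B 0ℓ → REL B C 0ℓ → REL A C 0ℓ
(R ⨾ Q) x z = ∃ λ y → R x y × Q y z

FunRel : {A B : Set} → (A → B) → REL A B 0ℓ
FunRel f x y = f x ≡ y

SpanRel : {K A B : Set} → (K → A) → (K → B) → REL A B 0ℓ
SpanRel l r x y = ∃ λ k → l k ≡ x × r k ≡ y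

module _ {K₁ K₂ S T G H : Set} {l₁ : K₁ → S} {r₁ : K₁ → T} {l₂ : K₂ → G} {r₂ : K₂ → H}
         {f : S → G} {g : T → H} {u : K₁ → K₂} where

  span-⨾-comm : Amalgamatesᶠ l₁ u f l₂ → (∀ k → f (l₁ k) ≡ l₂ (u k)) → (∀ k → g (r₁ k) ≡ r₂ (u k)) →
                ∀ x z → (SpanRel l₁ r₁ ⨾ FunRel g) x z ⇔ (FunRel f ⨾ SpanRel l₂ r₂) x z
  span-⨾-comm amalgamate left-comm right-comm x z = mk⇔ to from
    where
    to : (SpanRel l₁ r₁ ⨾ FunRel g) x z → (FunRel f ⨾ SpanRel l₂ r₂) x z
    to (_ , (k , refl , refl) , refl) = _ , refl , u k , sym (left-comm k) , sym (right-comm k)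

    from : (FunRel f ⨾ SpanRel l₂ r₂) x z → (SpanRel l₁ r₁ ⨾ FunRel g) x z
    from (_ , refl , k₂ , l₂k₂≡fx , refl) =
      let k , l₁k≡x , uk≡k₂ = amalgamate x k₂ (sym l₂k₂≡fx)
      in _ , (k , l₁k≡x , refl) , right-comm k ∙ cong r₂ uk≡k₂

  right-comm-from-span-⨾ : Injective _≡_ _≡_ l₂ → (∀ k → f (l₁ k) ≡ l₂ (u k)) →
                           (∀ x z → (SpanRel l₁ r₁ ⨾ FunRel g) x z → (FunRel f ⨾ SpanRel l₂ r₂) x z) →
                           ∀ k → g (r₁ k) ≡ r₂ (u k)
  right-comm-from-span-⨾ l₂-inj left-comm to k =
    let _ , fx≡y , k₂ , l₂k₂≡y , r₂k₂≡z = to (l₁ k) (g (r₁ k)) (r₁ k , (k , refl , refl) , refl)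
    in sym r₂k₂≡z ∙ cong r₂ (l₂-inj (l₂k₂≡y ∙ sym fx≡y ∙ left-comm k))

module _ {S T G H : Graph} (γ : Rule S T) (β : Rule G H) (f : Hom S G) (g : Hom T H)
         (u : Hom (apex γ) (apex β)) where

  ⊙-comm-from-square : IsPullback (left γ) u f (left β) → g ∘H right γ ≈ right β ∘H u →
                       ⟦ g ⟧ₜ ⊙ ⟦ γ ⟧ᵣ ≋ ⟦ β ⟧ᵣ ⊙ ⟦ f ⟧ₜ
  ⊙-comm-from-square pb (right-commV , right-commE) =
    let amalgamateV , amalgamateE = pullback⇒amalgamates (left γ) u f (left β) pb
    in span-⨾-comm amalgamateV (proj₁ (proj₁ pb)) right-commV ,
       span-⨾-comm amalgamateE (proj₂ (proj₁ pb)) right-commE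

  square-from-⊙-comm : IsMatch (left β) → f ∘H left γ ≈ left β ∘H u →
                       ⟦ g ⟧ₜ ⊙ ⟦ γ ⟧ᵣ ≋ ⟦ β ⟧ᵣ ⊙ ⟦ f ⟧ₜ → g ∘H right γ ≈ right β ∘H u
  square-from-⊙-comm (lV , lE) (left-commV , left-commE) (⊙-commV , ⊙-commE) =
    right-comm-from-span-⨾ lV left-commV (λ x z → Equivalence.to (⊙-commV x z)) ,
    right-comm-from-span-⨾ lE left-commE (λ x z → Equivalence.to (⊙-commE x z))

lemma1 : {L R G H S T : Graph}
         (α : Rule L R) (β : Rule G H) (γ : Rule S T)
         (f₁ : Hom L S) (f₂ : Hom S G) (g : Hom R H) (g₁ : Hom R T) →
         IsMatch f₁ → IsMatch f₂ → IsMatch g → IsMatch g₁ →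
         Derivation (f₂ ∘H f₁) α g β →
         Derivation f₁ α g₁ γ →
         Σ (Hom T H) λ g₂ →
           (IsMatch g₂ × (g₂ ∘H g₁ ≈ g) × (⟦ g₂ ⟧ₜ ⊙ ⟦ γ ⟧ᵣ ≋ ⟦ β ⟧ᵣ ⊙ ⟦ f₂ ⟧ₜ) ×
            Derivation f₁ α g₁ γ × Derivation f₂ γ g₂ β) ×
           (∀ (g₂' : Hom T H) →
              IsMatch g₂' → g₂' ∘H g₁ ≈ g → ⟦ g₂' ⟧ₜ ⊙ ⟦ γ ⟧ᵣ ≋ ⟦ β ⟧ᵣ ⊙ ⟦ f₂ ⟧ₜ →
              Derivation f₂ γ g₂' β →
              g₂' ≈ g₂)
lemma1 α β γ f₁ f₂ g g₁ f₁-match f₂-match g-match _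
       (_ , hβ , _ , fpbcβ , poβ , _) dγ@(_ , hγ , _ , fpbcγ , poγ , _) =
  g₂ , (g₂-match , g₂∘g₁≈g , ⊙-comm-from-square γ β f₂ g₂ u (proj₁ (proj₂ isFPBC)) g₂∘rγ≈rβ∘u ,
        dγ , (f₂-match , u , u-match , isFPBC , isPushout , g₂-match)) ,
  λ g₂' _ g₂'∘g₁≈g g₂'-⊙-comm _ → jointly-epi g₂' g₂
    (≗²-trans g₂'∘g₁≈g (≗²-sym g₂∘g₁≈g))
    (≗²-trans (square-from-⊙-comm γ β f₂ g₂' u (left-match β) (≗²-sym l₂∘u≈f₂∘l₁) g₂'-⊙-comm)
              (≗²-sym g₂∘rγ≈rβ∘u))
  where
  open FPBCDecomposition (left α) f₁ f₂ hγ (left γ) hβ (left β)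
                         f₁-match f₂-match (left-match γ) (left-match β) fpbcγ fpbcβ
  open PushoutDecomposition (right α) hγ g₁ (right γ) hβ g (right β) u poγ poβ u∘h₁≈h₂
    renaming (d to g₂; d∘b₁≈b₁' to g₂∘g₁≈g; d∘b₂≈b₂'∘c to g₂∘rγ≈rβ∘u)
  open PushoutProperties (right α) hγ g₁ (right γ) poγ using (jointly-epi)

  g₂-match : IsMatch g₂
  g₂-match = d-match (right-match α) u-match g-match (right-match β)
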